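{- Let $g(x),f(x)$ be formal power series with integer coefficients and $g(0)=f(0)=1$, let $A=(g(x),xf(x))$ with entries $a_{n,k}=[x^n]g(x)(xf(x))^k$, and let $\phi(x)$ be the reversion of $x/f(x)$. Let $c(A;1)$ be the lower-triangular matrix with $(n,k)$ entry $a_{2n,n+k}$. Then $$c(A;1)=\left(\frac{f(x)}{\phi'\!\left(\frac{x}{f(x)}\right)},\ \frac{x}{f(x)}\right)^{ -1}\cdot (g(x),xf(x)).$$
   Context: A Riordan array $(d(x),h(x))$, for formal power series $d,h$ with $d(0)\neq 0$, $h(0)=0$, $h'(0)\neq 0$, is the infinite lower-triangular matrix whose $(n,k)$ entry is $[x^n]d(x)h(x)^k$. Riordan arrays form a group under matrix multiplication, with $(d,h)\cdot(u,w)=(d(x)u(h(x)),w(h(x)))$ and $(d,h)^{ -1}=(1/d(\bar h),\bar h)$, where $\bar h$ is the reversion of $h$: the power series $u$ with $u(0)=0$ and $h(u(x))=x$. $\phi'$ denotes the derivative of $\phi$. -}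

module Defs where

open import Data.Nat using (ℕ; zero; suc; _∸_)
open import Data.Integer using (ℤ; +_; -_; _+_; _*_; 0ℤ; 1ℤ)
open import Data.List using (List; []; _∷_; zipWith; map; upTo)

-- Formal power series with integer coefficients: n ↦ [x^n]
Series : Set
Series = ℕ → ℤ

Σ< : ℕ → (ℕ → ℤ) → ℤ
Σ< zero    f = 0ℤ
Σ< (suc n) f = Σ< n f + f n

sumList : List ℤ → ℤ
sumList []       = 0ℤ
sumList (x ∷ xs) = x + sumList xs

one : Series
one zero    = 1ℤ
one (suc _) = 0ℤ

X : Series
X (suc zero) = 1ℤ
X _          = 0ℤ

mul : Series → Series → Series
mul a b n = Σ< (suc n) (λ i → a i * b (n ∸ i))

pow : Series → ℕ → Series
pow a zero    = one
pow a (suc k) = mul a (pow a k)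

xmul : Series → Series
xmul a zero    = 0ℤ
xmul a (suc n) = a n

-- composition u(h(x)); meaningful when h(0) = 0
compose : Series → Series → Series
compose u h n = Σ< (suc n) (λ k → u k * pow h k n)

deriv : Series → Series
deriv a n = (+ suc n) * a (suc n)

-- Multiplicative inverse 1/a of a series with a(0) = 1:
-- b_0 = 1, b_{m} = - Σ_{i=1}^{m} a_i b_{m-i}.
-- invList a n = [b_n, b_{n-1}, ..., b_0]
invList : Series → ℕ → List ℤ
invList a zero    = 1ℤ ∷ []
invList a (suc n) =
  let bs = invList a n in
  (- sumList (zipWith _*_ (map (λ i → a (suc i)) (upTo (suc n))) bs)) ∷ bs

headOr0 : List ℤ → ℤ
headOr0 []      = 0ℤ
headOr0 (x ∷ _) = x

inv : Series → Series
inv a n = headOr0 (invList a n)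

Riordan : Series → Series → ℕ → ℕ → ℤ
Riordan d h n k = mul d (pow h k) n

-- Product of lower-triangular infinite matrices: (PQ)_{n,k} = Σ_{j=0}^{n} P_{n,j} Q_{j,k}
matMul : (ℕ → ℕ → ℤ) → (ℕ → ℕ → ℤ) → ℕ → ℕ → ℤ
matMul P Q n k = Σ< (suc n) (λ j → P n j * Q j k)

-- Inverse of the Riordan array (d, h), given the reversion hbar of h:
-- (d,h)^{-1} = (1/d(hbar), hbar)
RiordanInv : Series → Series → ℕ → ℕ → ℤ
RiordanInv d hbar = Riordan (inv (compose d hbar)) hbar

IsReversionOf : Series → Series → Set
IsReversionOf u h = (u 0 ≡′ 0ℤ) × (∀ n → compose h u n ≡′ X n)
  where
  open import Relation.Binary.PropositionalEquality renaming (_≡_ to _≡′_)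
  open import Data.Product using (_×_)

-- Put h = x/f, so that φ is the compositional inverse of h. The heart of the matter is the
-- Lagrange inversion formula [xⁿ] F(φ)·φ′ = [xⁿ] F·fⁿ⁺¹. Both sides are linear in F and only
-- see F₀, …, Fₙ, so it suffices to compare them on the unitriangular family hʲ·h′. On the left,
-- hʲ(φ)·h′(φ)·φ′ = xʲ·(h∘φ)′ = xʲ. On the right, hʲ·h′·fⁿ⁺¹ = xʲ·h′·fᴺ⁺¹ with N = n − j, and
-- [xᴺ] h′·fᴺ⁺¹ = [xᴺ] fᴺ − [xᴺ⁻¹] f′·fᴺ⁻¹ = δ_{N,0} because (1/f)′·f = −f′/f.
-- Finally c(A;1)ₙₖ = [x²ⁿ] g·(xf)ⁿ⁺ᵏ = [xⁿ] fⁿ·b with b = g·(xf)ᵏ, whereas the (n,k) entry of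
-- (d,h)⁻¹·(g,xf) is [xⁿ] b(φ)/d(φ) with d(φ) = f(φ)/φ′, which the formula for F = b/f turns
-- into [xⁿ] b·fⁿ.

module Submission where

open import Defs
open import Data.Nat as ℕ using (ℕ; zero; suc; _∸_; _<_; _≤_; s≤s)
import Data.Nat.Properties as ℕₚ
open import Data.Nat.Induction using (<-rec)
open import Data.Integer using (ℤ; +_; -_; 0ℤ; 1ℤ; _+_; _*_)
open import Data.Integer.Properties
  using ( +-assoc; +-comm; +-identityˡ; +-identityʳ; +-inverseʳ
        ; *-assoc; *-comm; *-identityˡ; *-identityʳ; *-zeroʳ
        ; *-distribˡ-+; *-distribʳ-+; *-cancelˡ-≡; pos-+; +-0-abelianGroup )
open import Algebra.Properties.AbelianGroup +-0-abelianGroup using () renaming (∙-cancelʳ to +-cancelʳ)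
open import Data.Integer.Tactic.RingSolver using (solve-∀)
open import Data.List using (_∷_; zipWith; applyUpTo)
open import Data.List.Properties using (map-upTo)
open import Data.Product using (_,_)
open import Data.Sum using (inj₁; inj₂)
open import Relation.Binary.Bundles using (Setoid)
open import Relation.Binary.PropositionalEquality
import Relation.Binary.Reasoning.Setoid as SetoidReasoning

module ≗-Reasoning = SetoidReasoning (ℕ →-setoid ℤ)
open Setoid (ℕ →-setoid ℤ) using () renaming (refl to ≗-refl; sym to ≗-sym; trans to ≗-trans)

-- Finite sums

Σ<-cong-< : ∀ n {f g : ℕ → ℤ} → (∀ i → i < n → f i ≡ g i) → Σ< n f ≡ Σ< n g
Σ<-cong-< zero    eq = refl
Σ<-cong-< (suc n) eq = cong₂ _+_ (Σ<-cong-< n (λ i i<n → eq i (ℕₚ.m<n⇒m<1+n i<n))) (eq n ℕₚ.≤-refl)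

Σ<-cong : ∀ n {f g : ℕ → ℤ} → f ≗ g → Σ< n f ≡ Σ< n g
Σ<-cong n eq = Σ<-cong-< n (λ i _ → eq i)

Σ<-zero : ∀ n {f : ℕ → ℤ} → (∀ i → i < n → f i ≡ 0ℤ) → Σ< n f ≡ 0ℤ
Σ<-zero zero    eq = refl
Σ<-zero (suc n) eq =
  cong₂ _+_ (Σ<-zero n (λ i i<n → eq i (ℕₚ.m<n⇒m<1+n i<n))) (eq n ℕₚ.≤-refl)

Σ<-distrib-+ : ∀ n (f g : ℕ → ℤ) → Σ< n (λ i → f i + g i) ≡ Σ< n f + Σ< n g
Σ<-distrib-+ zero    f g = refl
Σ<-distrib-+ (suc n) f g =
  trans (cong (_+ (f n + g n)) (Σ<-distrib-+ n f g)) (interchange (Σ< n f) (Σ< n g) (f n) (g n))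
  where
  interchange : ∀ a b c d → (a + b) + (c + d) ≡ (a + c) + (b + d)
  interchange = solve-∀

*-distribˡ-Σ< : ∀ n c (f : ℕ → ℤ) → c * Σ< n f ≡ Σ< n (λ i → c * f i)
*-distribˡ-Σ< zero    c f = *-zeroʳ c
*-distribˡ-Σ< (suc n) c f = trans (*-distribˡ-+ c _ _) (cong (_+ c * f n) (*-distribˡ-Σ< n c f))

Σ<-unfoldˡ : ∀ n (f : ℕ → ℤ) → Σ< (suc n) f ≡ f 0 + Σ< n (λ i → f (suc i))
Σ<-unfoldˡ zero    f = trans (+-identityˡ (f 0)) (sym (+-identityʳ (f 0)))
Σ<-unfoldˡ (suc n) f = trans (cong (_+ f (suc n)) (Σ<-unfoldˡ n f)) (+-assoc (f 0) _ (f (suc n)))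

Σ<-swap : ∀ n m (F : ℕ → ℕ → ℤ) → Σ< n (λ i → Σ< m (F i)) ≡ Σ< m (λ j → Σ< n (λ i → F i j))
Σ<-swap zero    m F = sym (Σ<-zero m (λ _ _ → refl))
Σ<-swap (suc n) m F = trans (cong (_+ Σ< m (F n)) (Σ<-swap n m F)) (sym (Σ<-distrib-+ m _ _))

Σ<-extend : ∀ {m} n (f : ℕ → ℤ) → m ≤ n → (∀ i → m ≤ i → f i ≡ 0ℤ) → Σ< n f ≡ Σ< m f
Σ<-extend n f m≤n vanish with ℕₚ.m≤n⇒m<n∨m≡n m≤n
... | inj₂ refl = refl
Σ<-extend (suc n) f _ vanish | inj₁ m<1+n =
  trans (cong₂ _+_ (Σ<-extend n f m≤n vanish) (vanish n m≤n)) (+-identityʳ _)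
  where
  m≤n = ℕₚ.≤-pred m<1+n

-- Series arithmetic

infixl 6 _⊕_

_⊕_ : Series → Series → Series
(a ⊕ b) n = a n + b n

scale : ℤ → Series → Series
scale c a n = c * a n

zeroₛ : Series
zeroₛ _ = 0ℤ

tail : Series → Series
tail a n = a (suc n)

⊕-cong : ∀ {a a′ b b′} → a ≗ a′ → b ≗ b′ → a ⊕ b ≗ a′ ⊕ b′
⊕-cong p q n = cong₂ _+_ (p n) (q n)

xmul-cong : ∀ {a b} → a ≗ b → xmul a ≗ xmul b
xmul-cong p zero    = refl
xmul-cong p (suc n) = p n

mul-at-0 : ∀ a b → mul a b 0 ≡ a 0 * b 0
mul-at-0 a b = +-identityˡ _

tail-mul : ∀ a b → tail (mul a b) ≗ scale (a 0) (tail b) ⊕ mul (tail a) b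
tail-mul a b n = Σ<-unfoldˡ (suc n) _

mul-unfoldʳ : ∀ a b n → mul a b (suc n) ≡ mul a (tail b) n + a (suc n) * b 0
mul-unfoldʳ a b n =
  cong₂ _+_ (Σ<-cong-< (suc n) (λ i i≤n → cong (λ t → a i * b t) (ℕₚ.+-∸-assoc 1 (ℕₚ.≤-pred i≤n))))
            (cong (λ t → a (suc n) * b t) (ℕₚ.n∸n≡0 n))

mul-cong : ∀ {a a′ b b′} → a ≗ a′ → b ≗ b′ → mul a b ≗ mul a′ b′
mul-cong p q n = Σ<-cong (suc n) (λ i → cong₂ _*_ (p i) (q (n ∸ i)))

mul-congˡ : ∀ {a a′} b → a ≗ a′ → mul a b ≗ mul a′ b
mul-congˡ {a} {a′} b p = mul-cong {a} {a′} {b} {b} p (λ _ → refl)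

mul-congʳ : ∀ a {b b′} → b ≗ b′ → mul a b ≗ mul a b′
mul-congʳ a {b} {b′} p = mul-cong {a} {a} {b} {b′} (λ _ → refl) p

mul-congʳ-≤ : ∀ a {b b′} n → (∀ m → m ≤ n → b m ≡ b′ m) → mul a b n ≡ mul a b′ n
mul-congʳ-≤ a n eq = Σ<-cong (suc n) (λ i → cong (a i *_) (eq (n ∸ i) (ℕₚ.m∸n≤m n i)))

mul-congʳ-< : ∀ a → a 0 ≡ 0ℤ → ∀ {b b′} n → (∀ m → m < n → b m ≡ b′ m) → mul a b n ≡ mul a b′ n
mul-congʳ-< a a0 {b} {b′} zero    _  = trans (mul-at-0 a b) (trans (cong (_* b 0) a0)
                                          (sym (trans (mul-at-0 a b′) (cong (_* b′ 0) a0))))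
mul-congʳ-< a a0 {b} {b′} (suc n) eq = begin
  mul a b (suc n)                      ≡⟨ tail-mul a b n ⟩
  a 0 * b (suc n) + mul (tail a) b n   ≡⟨ cong₂ _+_ (cong (_* b (suc n)) a0)
                                           (mul-congʳ-≤ (tail a) n (λ m m≤n → eq m (s≤s m≤n))) ⟩
  0ℤ * b (suc n) + mul (tail a) b′ n   ≡⟨ cong (_+ mul (tail a) b′ n) (cong (_* b′ (suc n)) (sym a0)) ⟩
  a 0 * b′ (suc n) + mul (tail a) b′ n ≡⟨ sym (tail-mul a b′ n) ⟩
  mul a b′ (suc n)                     ∎
  where open ≡-Reasoning

mul-vanishesˡ : ∀ {a} b n → (∀ i → i ≤ n → a i ≡ 0ℤ) → mul a b n ≡ 0ℤ
mul-vanishesˡ b n vanish =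
  Σ<-zero (suc n) (λ i i≤n → cong (_* b (n ∸ i)) (vanish i (ℕₚ.≤-pred i≤n)))

mul-comm : ∀ a b → mul a b ≗ mul b a
mul-comm a b zero    = trans (mul-at-0 a b) (trans (*-comm (a 0) (b 0)) (sym (mul-at-0 b a)))
mul-comm a b (suc n) = begin
  mul a b (suc n)                      ≡⟨ tail-mul a b n ⟩
  a 0 * b (suc n) + mul (tail a) b n   ≡⟨ cong₂ _+_ (*-comm (a 0) (b (suc n))) (mul-comm (tail a) b n) ⟩
  b (suc n) * a 0 + mul b (tail a) n   ≡⟨ +-comm (b (suc n) * a 0) _ ⟩
  mul b (tail a) n + b (suc n) * a 0   ≡⟨ sym (mul-unfoldʳ b a n) ⟩
  mul b a (suc n)                      ∎
  where open ≡-Reasoning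

mul-distribʳ : ∀ a b c → mul (a ⊕ b) c ≗ mul a c ⊕ mul b c
mul-distribʳ a b c n =
  trans (Σ<-cong (suc n) (λ i → *-distribʳ-+ (c (n ∸ i)) (a i) (b i))) (Σ<-distrib-+ (suc n) _ _)

mul-distribˡ : ∀ a b c → mul a (b ⊕ c) ≗ mul a b ⊕ mul a c
mul-distribˡ a b c n =
  trans (Σ<-cong (suc n) (λ i → *-distribˡ-+ (a i) (b (n ∸ i)) (c (n ∸ i)))) (Σ<-distrib-+ (suc n) _ _)

mul-scaleˡ : ∀ c a b → mul (scale c a) b ≗ scale c (mul a b)
mul-scaleˡ c a b n =
  trans (Σ<-cong (suc n) (λ i → *-assoc c (a i) _)) (sym (*-distribˡ-Σ< (suc n) c _))

mul-scaleʳ : ∀ c a b → mul a (scale c b) ≗ scale c (mul a b)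
mul-scaleʳ c a b n =
  trans (Σ<-cong (suc n) (λ i → left-comm (a i) c (b (n ∸ i)))) (sym (*-distribˡ-Σ< (suc n) c _))
  where
  left-comm : ∀ x y z → x * (y * z) ≡ y * (x * z)
  left-comm = solve-∀

mul-zeroˡ : ∀ b → mul zeroₛ b ≗ zeroₛ
mul-zeroˡ b n = mul-vanishesˡ b n (λ _ _ → refl)

mul-identityˡ : ∀ b → mul one b ≗ b
mul-identityˡ b zero    = trans (mul-at-0 one b) (*-identityˡ (b 0))
mul-identityˡ b (suc n) = trans (tail-mul one b n)
  (trans (cong₂ _+_ (*-identityˡ (b (suc n))) (mul-zeroˡ b n)) (+-identityʳ (b (suc n))))

mul-identityʳ : ∀ b → mul b one ≗ b
mul-identityʳ b = ≗-trans (mul-comm b one) (mul-identityˡ b)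

mul-assoc : ∀ a b c → mul (mul a b) c ≗ mul a (mul b c)
mul-assoc a b c zero = begin
  mul (mul a b) c 0     ≡⟨ trans (mul-at-0 (mul a b) c) (cong (_* c 0) (mul-at-0 a b)) ⟩
  a 0 * b 0 * c 0       ≡⟨ *-assoc (a 0) (b 0) (c 0) ⟩
  a 0 * (b 0 * c 0)     ≡⟨ sym (trans (mul-at-0 a (mul b c)) (cong (a 0 *_) (mul-at-0 b c))) ⟩
  mul a (mul b c) 0     ∎
  where open ≡-Reasoning
mul-assoc a b c (suc n) = begin
  mul (mul a b) c (suc n)
    ≡⟨ tail-mul (mul a b) c n ⟩
  mul a b 0 * c (suc n) + mul (tail (mul a b)) c n
    ≡⟨ cong₂ _+_ (cong (_* c (suc n)) (mul-at-0 a b))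
                 (trans (mul-congˡ c (tail-mul a b) n) (mul-distribʳ (scale (a 0) (tail b)) (mul (tail a) b) c n)) ⟩
  a 0 * b 0 * c (suc n) + (mul (scale (a 0) (tail b)) c n + mul (mul (tail a) b) c n)
    ≡⟨ cong (λ t → a 0 * b 0 * c (suc n) + t) (cong₂ _+_ (mul-scaleˡ (a 0) (tail b) c n) (mul-assoc (tail a) b c n)) ⟩
  a 0 * b 0 * c (suc n) + (a 0 * mul (tail b) c n + mul (tail a) (mul b c) n)
    ≡⟨ regroup (a 0) (b 0) (c (suc n)) _ _ ⟩
  a 0 * (b 0 * c (suc n) + mul (tail b) c n) + mul (tail a) (mul b c) n
    ≡⟨ cong (λ t → a 0 * t + mul (tail a) (mul b c) n) (sym (tail-mul b c n)) ⟩
  a 0 * mul b c (suc n) + mul (tail a) (mul b c) n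
    ≡⟨ sym (tail-mul a (mul b c) n) ⟩
  mul a (mul b c) (suc n) ∎
  where
  open ≡-Reasoning
  regroup : ∀ x y z u v → x * y * z + (x * u + v) ≡ x * (y * z + u) + v
  regroup = solve-∀

mul-left-comm : ∀ a b c → mul a (mul b c) ≗ mul b (mul a c)
mul-left-comm a b c = begin
  mul a (mul b c) ≈⟨ ≗-sym (mul-assoc a b c) ⟩
  mul (mul a b) c ≈⟨ mul-congˡ c (mul-comm a b) ⟩
  mul (mul b a) c ≈⟨ mul-assoc b a c ⟩
  mul b (mul a c) ∎
  where open ≗-Reasoning

mul-interchange : ∀ a b c d → mul (mul a b) (mul c d) ≗ mul (mul a c) (mul b d)
mul-interchange a b c d = begin
  mul (mul a b) (mul c d) ≈⟨ mul-assoc a b (mul c d) ⟩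
  mul a (mul b (mul c d)) ≈⟨ mul-congʳ a (mul-left-comm b c d) ⟩
  mul a (mul c (mul b d)) ≈⟨ ≗-sym (mul-assoc a c (mul b d)) ⟩
  mul (mul a c) (mul b d) ∎
  where open ≗-Reasoning

mul-xmulˡ : ∀ a b → mul (xmul a) b ≗ xmul (mul a b)
mul-xmulˡ a b zero    = mul-at-0 (xmul a) b
mul-xmulˡ a b (suc n) = trans (tail-mul (xmul a) b n) (+-identityˡ _)

mul-X : ∀ b → mul X b ≗ xmul b
mul-X b = ≗-trans (mul-congˡ b X≗xmul-one) (≗-trans (mul-xmulˡ one b) (xmul-cong (mul-identityˡ b)))
  where
  X≗xmul-one : X ≗ xmul one
  X≗xmul-one zero          = refl
  X≗xmul-one (suc zero)    = refl
  X≗xmul-one (suc (suc n)) = refl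

-- Multiplicative inverse

inv-suc : ∀ a n → inv a (suc n) ≡ - Σ< (suc n) (λ i → a (suc i) * inv a (n ∸ i))
inv-suc a n = cong -_ (trans
  (cong₂ (λ as bs → sumList (zipWith _*_ as bs)) (map-upTo (λ i → a (suc i)) (suc n)) (invList-applyUpTo n))
  (sumList-zipWith (λ i → a (suc i)) (λ i → inv a (n ∸ i)) (suc n)))
  where
  invList-applyUpTo : ∀ n → invList a n ≡ applyUpTo (λ i → inv a (n ∸ i)) (suc n)
  invList-applyUpTo zero    = refl
  invList-applyUpTo (suc n) = cong (inv a (suc n) ∷_) (invList-applyUpTo n)
  sumList-zipWith : ∀ (F G : ℕ → ℤ) m →
                    sumList (zipWith _*_ (applyUpTo F m) (applyUpTo G m)) ≡ Σ< m (λ i → F i * G i)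
  sumList-zipWith F G zero    = refl
  sumList-zipWith F G (suc m) =
    trans (cong (λ t → F 0 * G 0 + t) (sumList-zipWith (λ i → F (suc i)) (λ i → G (suc i)) m))
          (sym (Σ<-unfoldˡ m (λ i → F i * G i)))

mul-invʳ : ∀ a → a 0 ≡ 1ℤ → mul a (inv a) ≗ one
mul-invʳ a a0 zero    = trans (mul-at-0 a (inv a)) (trans (*-identityʳ (a 0)) a0)
mul-invʳ a a0 (suc n) = begin
  mul a (inv a) (suc n)                      ≡⟨ tail-mul a (inv a) n ⟩
  a 0 * inv a (suc n) + mul (tail a) (inv a) n ≡⟨ cong₂ (λ x y → x * y + S) a0 (inv-suc a n) ⟩
  1ℤ * (- S) + S                             ≡⟨ cancel S ⟩
  0ℤ                                         ∎
  where
  open ≡-Reasoning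
  S = Σ< (suc n) (λ i → a (suc i) * inv a (n ∸ i))
  cancel : ∀ s → 1ℤ * (- s) + s ≡ 0ℤ
  cancel = solve-∀

mul-invˡ : ∀ a → a 0 ≡ 1ℤ → mul (inv a) a ≗ one
mul-invˡ a a0 = ≗-trans (mul-comm (inv a) a) (mul-invʳ a a0)

inv-mul-cancelˡ : ∀ a → a 0 ≡ 1ℤ → ∀ b → mul (inv a) (mul a b) ≗ b
inv-mul-cancelˡ a a0 b = begin
  mul (inv a) (mul a b) ≈⟨ ≗-sym (mul-assoc (inv a) a b) ⟩
  mul (mul (inv a) a) b ≈⟨ mul-congˡ b (mul-invˡ a a0) ⟩
  mul one b             ≈⟨ mul-identityˡ b ⟩
  b                     ∎
  where open ≗-Reasoning

-- Powers and shifts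

shift : ℕ → Series → Series
shift zero    a = a
shift (suc j) a = xmul (shift j a)

shift-cong : ∀ j {a b} → a ≗ b → shift j a ≗ shift j b
shift-cong zero    p = p
shift-cong (suc j) p = xmul-cong (shift-cong j p)

shift-below : ∀ j a {n} → n < j → shift j a n ≡ 0ℤ
shift-below (suc j) a {zero}  _         = refl
shift-below (suc j) a {suc n} (s≤s n<j) = shift-below j a n<j

shift-+ : ∀ j a m → shift j a (j ℕ.+ m) ≡ a m
shift-+ zero    a m = refl
shift-+ (suc j) a m = shift-+ j a m

mul-shiftˡ : ∀ j a b → mul (shift j a) b ≗ shift j (mul a b)
mul-shiftˡ zero    a b = ≗-refl
mul-shiftˡ (suc j) a b = ≗-trans (mul-xmulˡ (shift j a) b) (xmul-cong (mul-shiftˡ j a b))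

mul-shiftʳ : ∀ j a b → mul a (shift j b) ≗ shift j (mul a b)
mul-shiftʳ j a b =
  ≗-trans (mul-comm a (shift j b)) (≗-trans (mul-shiftˡ j b a) (shift-cong j (mul-comm b a)))

pow-cong : ∀ {a b} k → a ≗ b → pow a k ≗ pow b k
pow-cong         zero    p = ≗-refl
pow-cong {a} {b} (suc k) p = mul-cong {a} {b} {pow a k} {pow b k} p (pow-cong k p)

pow-at-0 : ∀ a → a 0 ≡ 1ℤ → ∀ j → pow a j 0 ≡ 1ℤ
pow-at-0 a a0 zero    = refl
pow-at-0 a a0 (suc j) = trans (mul-at-0 a (pow a j)) (cong₂ _*_ a0 (pow-at-0 a a0 j))

pow-vanishes-below : ∀ a → a 0 ≡ 0ℤ → ∀ k {n} → n < k → pow a k n ≡ 0ℤ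
pow-vanishes-below a a0 (suc k) {zero}  _         = trans (mul-at-0 a (pow a k)) (cong (_* pow a k 0) a0)
pow-vanishes-below a a0 (suc k) {suc n} (s≤s n<k) = begin
  mul a (pow a k) (suc n)                          ≡⟨ tail-mul a (pow a k) n ⟩
  a 0 * pow a k (suc n) + mul (tail a) (pow a k) n ≡⟨ cong₂ _+_ (cong (_* pow a k (suc n)) a0) tail-part ⟩
  0ℤ                                               ∎
  where
  open ≡-Reasoning
  tail-part : mul (tail a) (pow a k) n ≡ 0ℤ
  tail-part = Σ<-zero (suc n) (λ i _ →
    trans (cong (tail a i *_) (pow-vanishes-below a a0 k (ℕₚ.≤-<-trans (ℕₚ.m∸n≤m n i) n<k))) (*-zeroʳ (tail a i)))

pow-+ : ∀ a j k → pow a (j ℕ.+ k) ≗ mul (pow a j) (pow a k)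
pow-+ a zero    k = ≗-sym (mul-identityˡ (pow a k))
pow-+ a (suc j) k = ≗-trans (mul-congʳ a (pow-+ a j k)) (≗-sym (mul-assoc a (pow a j) (pow a k)))

pow-distrib-mul : ∀ a b k → pow (mul a b) k ≗ mul (pow a k) (pow b k)
pow-distrib-mul a b zero    = ≗-sym (mul-identityˡ one)
pow-distrib-mul a b (suc k) =
  ≗-trans (mul-congʳ (mul a b) (pow-distrib-mul a b k)) (mul-interchange a b (pow a k) (pow b k))

pow-one : ∀ k → pow one k ≗ one
pow-one zero    = ≗-refl
pow-one (suc k) = ≗-trans (mul-congʳ one (pow-one k)) (mul-identityˡ one)

pow-inv-mul-pow : ∀ a → a 0 ≡ 1ℤ → ∀ k → mul (pow (inv a) k) (pow a k) ≗ one
pow-inv-mul-pow a a0 k =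
  ≗-trans (≗-sym (pow-distrib-mul (inv a) a k)) (≗-trans (pow-cong k (mul-invˡ a a0)) (pow-one k))

pow-xmul : ∀ a j → pow (xmul a) j ≗ shift j (pow a j)
pow-xmul a zero    = ≗-refl
pow-xmul a (suc j) = begin
  mul (xmul a) (pow (xmul a) j)    ≈⟨ mul-xmulˡ a (pow (xmul a) j) ⟩
  xmul (mul a (pow (xmul a) j))    ≈⟨ xmul-cong (mul-congʳ a (pow-xmul a j)) ⟩
  xmul (mul a (shift j (pow a j))) ≈⟨ xmul-cong (mul-shiftʳ j a (pow a j)) ⟩
  xmul (shift j (mul a (pow a j))) ∎
  where open ≗-Reasoning

pow-X : ∀ j → pow X j ≗ shift j one
pow-X zero    = ≗-refl
pow-X (suc j) = ≗-trans (mul-X (pow X j)) (xmul-cong (pow-X j))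

-- Composition

compose-at-0 : ∀ u h → compose u h 0 ≡ u 0
compose-at-0 u h = trans (+-identityˡ (u 0 * 1ℤ)) (*-identityʳ (u 0))

compose-truncate : ∀ u h → h 0 ≡ 0ℤ → ∀ M {n} → n < M → compose u h n ≡ Σ< M (λ k → u k * pow h k n)
compose-truncate u h h0 M n<M = sym (Σ<-extend M _ n<M
  (λ k n<k → trans (cong (u k *_) (pow-vanishes-below h h0 k n<k)) (*-zeroʳ (u k))))

compose-vanishes : ∀ {u} h n → (∀ i → i ≤ n → u i ≡ 0ℤ) → ∀ m → m ≤ n → compose u h m ≡ 0ℤ
compose-vanishes h n vanish m m≤n =
  Σ<-zero (suc m) (λ k k≤m → cong (_* pow h k m) (vanish k (ℕₚ.≤-trans (ℕₚ.≤-pred k≤m) m≤n)))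

mul-Σ< : ∀ a M (c : ℕ → ℤ) (S : ℕ → Series) n →
         mul a (λ m → Σ< M (λ k → c k * S k m)) n ≡ Σ< M (λ k → c k * mul a (S k) n)
mul-Σ< a M c S n = begin
  Σ< (suc n) (λ i → a i * Σ< M (λ k → c k * S k (n ∸ i)))   ≡⟨ Σ<-cong (suc n) (λ i → *-distribˡ-Σ< M (a i) _) ⟩
  Σ< (suc n) (λ i → Σ< M (λ k → a i * (c k * S k (n ∸ i)))) ≡⟨ Σ<-swap (suc n) M _ ⟩
  Σ< M (λ k → Σ< (suc n) (λ i → a i * (c k * S k (n ∸ i)))) ≡⟨ Σ<-cong M (λ k → Σ<-cong (suc n) (λ i →
                                                                   left-comm (a i) (c k) (S k (n ∸ i)))) ⟩
  Σ< M (λ k → Σ< (suc n) (λ i → c k * (a i * S k (n ∸ i)))) ≡⟨ Σ<-cong M (λ k → sym (*-distribˡ-Σ< (suc n) (c k) _)) ⟩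
  Σ< M (λ k → c k * mul a (S k) n)                          ∎
  where
  open ≡-Reasoning
  left-comm : ∀ x y z → x * (y * z) ≡ y * (x * z)
  left-comm = solve-∀

compose-unfold : ∀ u h → h 0 ≡ 0ℤ → compose u h ≗ scale (u 0) one ⊕ mul h (compose (tail u) h)
compose-unfold u h h0 n = begin
  compose u h n                                                   ≡⟨ compose-truncate u h h0 (suc (suc n)) (ℕₚ.m<n⇒m<1+n (ℕₚ.n<1+n n)) ⟩
  Σ< (suc (suc n)) (λ k → u k * pow h k n)                        ≡⟨ Σ<-unfoldˡ (suc n) _ ⟩
  u 0 * one n + Σ< (suc n) (λ k → u (suc k) * mul h (pow h k) n)  ≡⟨ cong (λ t → u 0 * one n + t) (sym (mul-Σ< h (suc n) (tail u) (pow h) n)) ⟩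
  u 0 * one n + mul h (λ m → Σ< (suc n) (λ k → u (suc k) * pow h k m)) n
    ≡⟨ cong (λ t → u 0 * one n + t) (mul-congʳ-≤ h n (λ m m≤n → sym (compose-truncate (tail u) h h0 (suc n) (s≤s m≤n)))) ⟩
  u 0 * one n + mul h (compose (tail u) h) n                      ∎
  where open ≡-Reasoning

compose-congˡ : ∀ {u v} h → u ≗ v → compose u h ≗ compose v h
compose-congˡ h p n = Σ<-cong (suc n) (λ k → cong (_* pow h k n) (p k))

compose-congʳ : ∀ u {h h′} → h ≗ h′ → compose u h ≗ compose u h′
compose-congʳ u {h} {h′} p n = Σ<-cong (suc n) (λ k → cong (u k *_) (pow-cong {h} {h′} k p n))

compose-⊕ : ∀ a b h → compose (a ⊕ b) h ≗ compose a h ⊕ compose b h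
compose-⊕ a b h n =
  trans (Σ<-cong (suc n) (λ k → *-distribʳ-+ (pow h k n) (a k) (b k))) (Σ<-distrib-+ (suc n) _ _)

compose-scale : ∀ c a h → compose (scale c a) h ≗ scale c (compose a h)
compose-scale c a h n =
  trans (Σ<-cong (suc n) (λ k → *-assoc c (a k) (pow h k n))) (sym (*-distribˡ-Σ< (suc n) c _))

compose-one : ∀ h → compose one h ≗ one
compose-one h n = trans (Σ<-unfoldˡ n (λ k → one k * pow h k n))
  (trans (cong₂ _+_ (*-identityˡ (one n)) (Σ<-zero n (λ _ _ → refl))) (+-identityʳ (one n)))

compose-constant : ∀ c h → compose (scale c one) h ≗ scale c one
compose-constant c h = ≗-trans (compose-scale c one h) (λ n → cong (c *_) (compose-one h n))

compose-xmul : ∀ a h → h 0 ≡ 0ℤ → compose (xmul a) h ≗ mul h (compose a h)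
compose-xmul a h h0 n = trans (compose-unfold (xmul a) h h0 n) (+-identityˡ _)

compose-mul : ∀ h → h 0 ≡ 0ℤ → ∀ u v → compose (mul u v) h ≗ mul (compose u h) (compose v h)
compose-mul h h0 u v n = <-rec P step n u v
  where
  c : Series → Series
  c w = compose w h
  P : ℕ → Set
  P n = ∀ u v → c (mul u v) n ≡ mul (c u) (c v) n
  step : ∀ n → (∀ {m} → m < n → P m) → P n
  step n IH u v = begin
    c (mul u v) n
      ≡⟨ compose-unfold (mul u v) h h0 n ⟩
    mul u v 0 * one n + mul h (c (tail (mul u v))) n
      ≡⟨ cong₂ (λ x y → x * one n + y) (mul-at-0 u v)
               (trans (mul-congʳ h (≗-trans (compose-congˡ h (tail-mul u v)) (compose-⊕ (scale (u 0) (tail v)) (mul (tail u) v) h)) n)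
                      (mul-distribˡ h (c (scale (u 0) (tail v))) (c (mul (tail u) v)) n)) ⟩
    u 0 * v 0 * one n + (mul h (c (scale (u 0) (tail v))) n + mul h (c (mul (tail u) v)) n)
      ≡⟨ cong (λ t → u 0 * v 0 * one n + t) (cong₂ _+_
           (trans (mul-congʳ h (compose-scale (u 0) (tail v) h) n) (mul-scaleʳ (u 0) h (c (tail v)) n))
           (mul-congʳ-< h h0 n (λ m m<n → IH m<n (tail u) v))) ⟩
    u 0 * v 0 * one n + (u 0 * mul h (c (tail v)) n + mul h (mul (c (tail u)) (c v)) n)
      ≡⟨ regroup (u 0) (v 0) (one n) _ _ ⟩
    u 0 * (v 0 * one n + mul h (c (tail v)) n) + mul h (mul (c (tail u)) (c v)) n
      ≡⟨ cong₂ (λ x y → u 0 * x + y) (sym (compose-unfold v h h0 n)) (sym (mul-assoc h (c (tail u)) (c v) n)) ⟩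
    u 0 * c v n + mul (mul h (c (tail u))) (c v) n
      ≡⟨ cong (_+ mul (mul h (c (tail u))) (c v) n)
              (sym (trans (mul-scaleˡ (u 0) one (c v) n) (cong (u 0 *_) (mul-identityˡ (c v) n)))) ⟩
    mul (scale (u 0) one) (c v) n + mul (mul h (c (tail u))) (c v) n
      ≡⟨ sym (mul-distribʳ (scale (u 0) one) (mul h (c (tail u))) (c v) n) ⟩
    mul (scale (u 0) one ⊕ mul h (c (tail u))) (c v) n
      ≡⟨ sym (mul-congˡ (c v) (compose-unfold u h h0) n) ⟩
    mul (c u) (c v) n ∎
    where
    open ≡-Reasoning
    regroup : ∀ a b o x y → a * b * o + (a * x + y) ≡ a * (b * o + x) + y
    regroup = solve-∀

compose-pow : ∀ u h → h 0 ≡ 0ℤ → ∀ j → compose (pow u j) h ≗ pow (compose u h) j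
compose-pow u h h0 zero    = compose-one h
compose-pow u h h0 (suc j) =
  ≗-trans (compose-mul h h0 u (pow u j)) (mul-congʳ (compose u h) (compose-pow u h h0 j))

compose-identityʳ : ∀ u → compose u X ≗ u
compose-identityʳ u zero    = compose-at-0 u X
compose-identityʳ u (suc n) = begin
  compose u X (suc n)                                 ≡⟨ compose-unfold u X refl (suc n) ⟩
  u 0 * 0ℤ + mul X (compose (tail u) X) (suc n)       ≡⟨ cong₂ _+_ (*-zeroʳ (u 0)) (mul-X (compose (tail u) X) (suc n)) ⟩
  0ℤ + compose (tail u) X n                           ≡⟨ +-identityˡ _ ⟩
  compose (tail u) X n                                ≡⟨ compose-identityʳ (tail u) n ⟩
  u (suc n)                                           ∎
  where open ≡-Reasoning

compose-assoc : ∀ h φ → h 0 ≡ 0ℤ → φ 0 ≡ 0ℤ → ∀ v → compose (compose v h) φ ≗ compose v (compose h φ)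
compose-assoc h φ h0 φ0 v n = <-rec P step n v
  where
  H = compose h φ
  H0 : H 0 ≡ 0ℤ
  H0 = trans (compose-at-0 h φ) h0
  P : ℕ → Set
  P n = ∀ v → compose (compose v h) φ n ≡ compose v H n
  step : ∀ n → (∀ {m} → m < n → P m) → P n
  step n IH v = begin
    compose (compose v h) φ n
      ≡⟨ trans (compose-congˡ φ (compose-unfold v h h0) n) (compose-⊕ (scale (v 0) one) (mul h (compose (tail v) h)) φ n) ⟩
    compose (scale (v 0) one) φ n + compose (mul h (compose (tail v) h)) φ n
      ≡⟨ cong₂ _+_ (compose-constant (v 0) φ n) (compose-mul φ φ0 h (compose (tail v) h) n) ⟩
    v 0 * one n + mul H (compose (compose (tail v) h) φ) n
      ≡⟨ cong (λ t → v 0 * one n + t) (mul-congʳ-< H H0 n (λ m m<n → IH m<n (tail v))) ⟩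
    v 0 * one n + mul H (compose (tail v) H) n
      ≡⟨ sym (compose-unfold v H H0 n) ⟩
    compose v H n ∎
    where open ≡-Reasoning

-- Formal derivative

deriv-cong : ∀ {a b} → a ≗ b → deriv a ≗ deriv b
deriv-cong p n = cong (+ suc n *_) (p (suc n))

deriv-⊕ : ∀ a b → deriv (a ⊕ b) ≗ deriv a ⊕ deriv b
deriv-⊕ a b n = *-distribˡ-+ (+ suc n) (a (suc n)) (b (suc n))

deriv-one : deriv one ≗ zeroₛ
deriv-one n = *-zeroʳ (+ suc n)

deriv-constant : ∀ c → deriv (scale c one) ≗ zeroₛ
deriv-constant c n = trans (cong (+ suc n *_) (*-zeroʳ c)) (*-zeroʳ (+ suc n))

deriv-X : deriv X ≗ one
deriv-X zero    = refl
deriv-X (suc n) = *-zeroʳ (+ suc (suc n))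

deriv-unfold : ∀ a → deriv a ≗ tail a ⊕ xmul (deriv (tail a))
deriv-unfold a zero    = trans (*-identityˡ (a 1)) (sym (+-identityʳ (a 1)))
deriv-unfold a (suc n) = suc-* (+ suc n) (a (suc (suc n)))
  where
  suc-* : ∀ x y → (1ℤ + x) * y ≡ y + x * y
  suc-* = solve-∀

deriv-mul : ∀ a b → deriv (mul a b) ≗ mul (deriv a) b ⊕ mul a (deriv b)
deriv-mul a b n = begin
  + suc n * Σ< (suc (suc n)) F
    ≡⟨ *-distribˡ-Σ< (suc (suc n)) (+ suc n) F ⟩
  Σ< (suc (suc n)) (λ i → + suc n * F i)
    ≡⟨ Σ<-cong-< (suc (suc n)) (λ i i<2+n → cong (_* F i) (split i (ℕₚ.≤-pred i<2+n))) ⟩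
  Σ< (suc (suc n)) (λ i → (+ i + + (suc n ∸ i)) * F i)
    ≡⟨ trans (Σ<-cong (suc (suc n)) (λ i → *-distribʳ-+ (F i) (+ i) (+ (suc n ∸ i)))) (Σ<-distrib-+ (suc (suc n)) _ _) ⟩
  Σ< (suc (suc n)) (λ i → + i * F i) + Σ< (suc (suc n)) (λ i → + (suc n ∸ i) * F i)
    ≡⟨ cong₂ _+_ left-factor right-factor ⟩
  mul (deriv a) b n + mul a (deriv b) n ∎
  where
  open ≡-Reasoning
  F : ℕ → ℤ
  F i = a i * b (suc n ∸ i)
  split : ∀ i → i ≤ suc n → + suc n ≡ + i + + (suc n ∸ i)
  split i i≤ = trans (cong +_ (sym (ℕₚ.m+[n∸m]≡n i≤))) (pos-+ i (suc n ∸ i))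
  left-comm : ∀ x y z → x * (y * z) ≡ y * (x * z)
  left-comm = solve-∀
  left-factor : Σ< (suc (suc n)) (λ i → + i * F i) ≡ mul (deriv a) b n
  left-factor = trans (Σ<-unfoldˡ (suc n) (λ i → + i * F i)) (trans (+-identityˡ _)
    (Σ<-cong (suc n) (λ i → sym (*-assoc (+ suc i) (a (suc i)) (b (n ∸ i))))))
  right-factor : Σ< (suc (suc n)) (λ i → + (suc n ∸ i) * F i) ≡ mul a (deriv b) n
  right-factor = trans
    (cong₂ _+_ (Σ<-cong-< (suc n) (λ i i≤n →
                 trans (cong (λ t → + t * (a i * b t)) (ℕₚ.+-∸-assoc 1 (ℕₚ.≤-pred i≤n)))
                       (left-comm (+ suc (n ∸ i)) (a i) (b (suc (n ∸ i))))))
               (cong (λ t → + t * (a (suc n) * b t)) (ℕₚ.n∸n≡0 n)))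
    (+-identityʳ _)

deriv-pow : ∀ a k → deriv (pow a (suc k)) ≗ scale (+ suc k) (mul (deriv a) (pow a k))
deriv-pow a zero = begin
  deriv (mul a one)                   ≈⟨ deriv-cong (mul-identityʳ a) ⟩
  deriv a                             ≈⟨ ≗-sym (mul-identityʳ (deriv a)) ⟩
  mul (deriv a) one                   ≈⟨ (λ n → sym (*-identityˡ (mul (deriv a) one n))) ⟩
  scale (+ 1) (mul (deriv a) one)     ∎
  where open ≗-Reasoning
deriv-pow a (suc k) = begin
  deriv (mul a P)
    ≈⟨ deriv-mul a P ⟩
  mul (deriv a) P ⊕ mul a (deriv P)
    ≈⟨ ⊕-cong {mul (deriv a) P} ≗-refl (mul-congʳ a (deriv-pow a k)) ⟩
  mul (deriv a) P ⊕ mul a (scale (+ suc k) (mul (deriv a) (pow a k)))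
    ≈⟨ ⊕-cong {mul (deriv a) P} ≗-refl
         (≗-trans (mul-scaleʳ (+ suc k) a (mul (deriv a) (pow a k))) (λ n → cong (+ suc k *_) (mul-left-comm a (deriv a) (pow a k) n))) ⟩
  mul (deriv a) P ⊕ scale (+ suc k) (mul (deriv a) P)
    ≈⟨ (λ n → sym (suc-* (+ suc k) (mul (deriv a) P n))) ⟩
  scale (+ suc (suc k)) (mul (deriv a) P) ∎
  where
  open ≗-Reasoning
  P = pow a (suc k)
  suc-* : ∀ x y → (1ℤ + x) * y ≡ y + x * y
  suc-* = solve-∀

pow-diagonal-coeff : ∀ a k → pow a (suc k) (suc k) ≡ mul (deriv a) (pow a k) k
pow-diagonal-coeff a k = *-cancelˡ-≡ (+ suc k) _ _ (deriv-pow a k k)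

deriv-inv-leibniz : ∀ a → a 0 ≡ 1ℤ → mul (deriv (inv a)) a ⊕ mul (inv a) (deriv a) ≗ zeroₛ
deriv-inv-leibniz a a0 =
  ≗-trans (≗-sym (deriv-mul (inv a) a)) (≗-trans (deriv-cong (mul-invˡ a a0)) deriv-one)

deriv-compose : ∀ φ → φ 0 ≡ 0ℤ → ∀ u → deriv (compose u φ) ≗ mul (compose (deriv u) φ) (deriv φ)
deriv-compose φ φ0 u n = <-rec P step n u
  where
  c : Series → Series
  c w = compose w φ
  φ′ = deriv φ
  P : ℕ → Set
  P n = ∀ u → deriv (c u) n ≡ mul (c (deriv u)) φ′ n
  step : ∀ n → (∀ {m} → m < n → P m) → P n
  step n IH u = begin
    deriv (c u) n
      ≡⟨ trans (deriv-cong (compose-unfold u φ φ0) n) (deriv-⊕ (scale (u 0) one) (mul φ (c (tail u))) n) ⟩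
    deriv (scale (u 0) one) n + deriv (mul φ (c (tail u))) n
      ≡⟨ cong₂ _+_ (deriv-constant (u 0) n) (deriv-mul φ (c (tail u)) n) ⟩
    0ℤ + (mul φ′ (c (tail u)) n + mul φ (deriv (c (tail u))) n)
      ≡⟨ +-identityˡ _ ⟩
    mul φ′ (c (tail u)) n + mul φ (deriv (c (tail u))) n
      ≡⟨ cong₂ _+_ (mul-comm φ′ (c (tail u)) n) (mul-congʳ-< φ φ0 n (λ m m<n → IH m<n (tail u))) ⟩
    mul (c (tail u)) φ′ n + mul φ (mul (c (deriv (tail u))) φ′) n
      ≡⟨ cong (λ t → mul (c (tail u)) φ′ n + t) (sym (mul-assoc φ (c (deriv (tail u))) φ′ n)) ⟩
    mul (c (tail u)) φ′ n + mul (mul φ (c (deriv (tail u)))) φ′ n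
      ≡⟨ sym (mul-distribʳ (c (tail u)) (mul φ (c (deriv (tail u)))) φ′ n) ⟩
    mul (c (tail u) ⊕ mul φ (c (deriv (tail u)))) φ′ n
      ≡⟨ sym (mul-congˡ φ′ compose-deriv-unfold n) ⟩
    mul (c (deriv u)) φ′ n ∎
    where
    open ≡-Reasoning
    compose-deriv-unfold : c (deriv u) ≗ c (tail u) ⊕ mul φ (c (deriv (tail u)))
    compose-deriv-unfold = ≗-trans (compose-congˡ φ (deriv-unfold u))
      (≗-trans (compose-⊕ (tail u) (xmul (deriv (tail u))) φ)
               (⊕-cong {c (tail u)} ≗-refl (compose-xmul (deriv (tail u)) φ φ0)))

-- Riordan arrays and compositional inverses

riordan-apply : ∀ d φ → φ 0 ≡ 0ℤ → ∀ b n → Σ< (suc n) (λ j → Riordan d φ n j * b j) ≡ mul d (compose b φ) n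
riordan-apply d φ φ0 b n = begin
  Σ< (suc n) (λ j → mul d (pow φ j) n * b j)       ≡⟨ Σ<-cong (suc n) (λ j → *-comm (mul d (pow φ j) n) (b j)) ⟩
  Σ< (suc n) (λ j → b j * mul d (pow φ j) n)       ≡⟨ sym (mul-Σ< d (suc n) b (pow φ) n) ⟩
  mul d (λ m → Σ< (suc n) (λ j → b j * pow φ j m)) n
    ≡⟨ mul-congʳ-≤ d n (λ m m≤n → sym (compose-truncate b φ φ0 (suc n) (s≤s m≤n))) ⟩
  mul d (compose b φ) n                            ∎
  where open ≡-Reasoning

riordan-xmul-shift : ∀ g f n m k →
                     Riordan g (xmul f) (n ℕ.+ m) (n ℕ.+ k) ≡ mul (pow f n) (mul g (pow (xmul f) k)) m
riordan-xmul-shift g f n m k = trans (shifted (n ℕ.+ m)) (shift-+ n (mul (pow f n) column) m)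
  where
  column = mul g (pow (xmul f) k)
  shifted : mul g (pow (xmul f) (n ℕ.+ k)) ≗ shift n (mul (pow f n) column)
  shifted = begin
    mul g (pow (xmul f) (n ℕ.+ k))              ≈⟨ mul-congʳ g (pow-+ (xmul f) n k) ⟩
    mul g (mul (pow (xmul f) n) (pow (xmul f) k)) ≈⟨ mul-left-comm g (pow (xmul f) n) (pow (xmul f) k) ⟩
    mul (pow (xmul f) n) column                 ≈⟨ mul-congˡ column (pow-xmul f n) ⟩
    mul (shift n (pow f n)) column              ≈⟨ mul-shiftˡ n (pow f n) column ⟩
    shift n (mul (pow f n) column)              ∎
    where open ≗-Reasoning

mul-inv-pow-suc : ∀ a → a 0 ≡ 1ℤ → ∀ b n → mul (mul b (inv a)) (pow a (suc n)) ≗ mul (pow a n) b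
mul-inv-pow-suc a a0 b n = begin
  mul (mul b (inv a)) (mul a (pow a n)) ≈⟨ mul-congˡ (mul a (pow a n)) (mul-comm b (inv a)) ⟩
  mul (mul (inv a) b) (mul a (pow a n)) ≈⟨ mul-interchange (inv a) b a (pow a n) ⟩
  mul (mul (inv a) a) (mul b (pow a n)) ≈⟨ mul-congˡ (mul b (pow a n)) (mul-invˡ a a0) ⟩
  mul one (mul b (pow a n))             ≈⟨ mul-identityˡ (mul b (pow a n)) ⟩
  mul b (pow a n)                       ≈⟨ mul-comm b (pow a n) ⟩
  mul (pow a n) b                       ∎
  where open ≗-Reasoning

compose-reversion : ∀ h φ → h 0 ≡ 0ℤ → φ 0 ≡ 0ℤ → compose h φ ≗ X → ∀ v → compose (compose v h) φ ≗ v
compose-reversion h φ h0 φ0 h∘φ v = begin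
  compose (compose v h) φ ≈⟨ compose-assoc h φ h0 φ0 v ⟩
  compose v (compose h φ) ≈⟨ compose-congʳ v h∘φ ⟩
  compose v X             ≈⟨ compose-identityʳ v ⟩
  v                       ∎
  where open ≗-Reasoning

reversion-deriv : ∀ h φ → φ 0 ≡ 0ℤ → compose h φ ≗ X → mul (compose (deriv h) φ) (deriv φ) ≗ one
reversion-deriv h φ φ0 h∘φ = ≗-trans (≗-sym (deriv-compose φ φ0 h)) (≗-trans (deriv-cong h∘φ) deriv-X)

-- Lagrange inversion

module Lagrange (f : Series) (f0 : f 0 ≡ 1ℤ) where

  h : Series
  h = xmul (inv f)

  basis : ℕ → Series
  basis j = mul (pow h j) (deriv h)

  basis-shift : ∀ j → basis j ≗ shift j (mul (pow (inv f) j) (deriv h))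
  basis-shift j = ≗-trans (mul-congˡ (deriv h) (pow-xmul (inv f) j)) (mul-shiftˡ j (pow (inv f) j) (deriv h))

  basis-below : ∀ j {i} → i < j → basis j i ≡ 0ℤ
  basis-below j {i} i<j = trans (basis-shift j i) (shift-below j _ i<j)

  basis-diagonal : ∀ j → basis j j ≡ 1ℤ
  basis-diagonal j = begin
    basis j j            ≡⟨ basis-shift j j ⟩
    shift j A j          ≡⟨ cong (shift j A) (sym (ℕₚ.+-identityʳ j)) ⟩
    shift j A (j ℕ.+ 0)  ≡⟨ shift-+ j A 0 ⟩
    A 0                  ≡⟨ mul-at-0 (pow (inv f) j) (deriv h) ⟩
    pow (inv f) j 0 * 1ℤ ≡⟨ cong (_* 1ℤ) (pow-at-0 (inv f) refl j) ⟩
    1ℤ                   ∎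
    where
    open ≡-Reasoning
    A = mul (pow (inv f) j) (deriv h)

  deriv-h-coeff-pow : ∀ N → mul (deriv h) (pow f (suc N)) N ≡ one N
  deriv-h-coeff-pow N = trans expand (diagonal N)
    where
    u = inv f
    expand : mul (deriv h) (pow f (suc N)) N ≡ pow f N N + xmul (mul (deriv u) (pow f (suc N))) N
    expand = trans (mul-congˡ (pow f (suc N)) (deriv-unfold h) N)
      (trans (mul-distribʳ u (xmul (deriv u)) (pow f (suc N)) N)
             (cong₂ _+_ (inv-mul-cancelˡ f f0 (pow f N) N) (mul-xmulˡ (deriv u) (pow f (suc N)) N)))
    diagonal : ∀ N → pow f N N + xmul (mul (deriv u) (pow f (suc N))) N ≡ one N
    diagonal zero    = refl
    diagonal (suc M) = begin
      pow f (suc M) (suc M) + mul u′ (mul f P) M         ≡⟨ cong (_+ mul u′ (mul f P) M) (pow-diagonal-coeff f M) ⟩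
      mul f′ (pow f M) M + mul u′ (mul f P) M            ≡⟨ +-comm (mul f′ (pow f M) M) _ ⟩
      mul u′ (mul f P) M + mul f′ (pow f M) M
        ≡⟨ cong₂ _+_ (sym (mul-assoc u′ f P M)) (sym (regroup M)) ⟩
      mul (mul u′ f) P M + mul (mul u f′) P M            ≡⟨ sym (mul-distribʳ (mul u′ f) (mul u f′) P M) ⟩
      mul (mul u′ f ⊕ mul u f′) P M                      ≡⟨ mul-congˡ P (deriv-inv-leibniz f f0) M ⟩
      mul zeroₛ P M                                      ≡⟨ mul-zeroˡ P M ⟩
      0ℤ                                                 ∎
      where
      open ≡-Reasoning
      u′ = deriv u
      f′ = deriv f
      P = pow f (suc M)
      regroup : mul (mul u f′) (mul f (pow f M)) ≗ mul f′ (pow f M)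
      regroup = ≗-trans (mul-assoc u f′ (mul f (pow f M)))
        (≗-trans (mul-congʳ u (mul-left-comm f′ f (pow f M))) (inv-mul-cancelˡ f f0 (mul f′ (pow f M))))

  basis-coeff-pow : ∀ j n → mul (basis j) (pow f (suc n)) n ≡ pow X j n
  basis-coeff-pow j n with ℕₚ.≤-<-connex j n
  ... | inj₂ n<j = trans (mul-vanishesˡ (pow f (suc n)) n (λ i i≤n → basis-below j (ℕₚ.≤-<-trans i≤n n<j)))
                         (sym (pow-vanishes-below X refl j n<j))
  ... | inj₁ j≤n with ℕₚ.m≤n⇒∃[o]m+o≡n j≤n
  ...   | N , refl = begin
    mul (basis j) F (j ℕ.+ N)
      ≡⟨ trans (mul-congˡ F (basis-shift j) (j ℕ.+ N)) (mul-shiftˡ j (mul Uʲ h′) F (j ℕ.+ N)) ⟩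
    shift j (mul (mul Uʲ h′) F) (j ℕ.+ N)          ≡⟨ shift-+ j (mul (mul Uʲ h′) F) N ⟩
    mul (mul Uʲ h′) F N                            ≡⟨ mul-congʳ (mul Uʲ h′) split-power N ⟩
    mul (mul Uʲ h′) (mul (pow f j) F₁) N           ≡⟨ mul-interchange Uʲ h′ (pow f j) F₁ N ⟩
    mul (mul Uʲ (pow f j)) (mul h′ F₁) N           ≡⟨ mul-congˡ (mul h′ F₁) (pow-inv-mul-pow f f0 j) N ⟩
    mul one (mul h′ F₁) N                          ≡⟨ mul-identityˡ (mul h′ F₁) N ⟩
    mul h′ F₁ N                                    ≡⟨ deriv-h-coeff-pow N ⟩
    one N                                          ≡⟨ sym (shift-+ j one N) ⟩
    shift j one (j ℕ.+ N)                          ≡⟨ sym (pow-X j (j ℕ.+ N)) ⟩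
    pow X j (j ℕ.+ N)                              ∎
    where
    open ≡-Reasoning
    Uʲ = pow (inv f) j
    h′ = deriv h
    F = pow f (suc (j ℕ.+ N))
    F₁ = pow f (suc N)
    split-power : F ≗ mul (pow f j) F₁
    split-power m = trans (cong (λ t → pow f t m) (sym (ℕₚ.+-suc j N))) (pow-+ f j (suc N) m)

  d : Series → Series
  d φ = mul f (inv (compose (deriv φ) h))

  module _ (φ : Series) (φ0 : φ 0 ≡ 0ℤ) (h∘φ≗X : compose h φ ≗ X) where

    basis-coeff-compose : ∀ j → mul (compose (basis j) φ) (deriv φ) ≗ pow X j
    basis-coeff-compose j = begin
      mul (compose (basis j) φ) (deriv φ)                    ≈⟨ mul-congˡ (deriv φ) (compose-mul φ φ0 (pow h j) (deriv h)) ⟩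
      mul (mul (compose (pow h j) φ) h′∘φ) (deriv φ)         ≈⟨ mul-assoc (compose (pow h j) φ) h′∘φ (deriv φ) ⟩
      mul (compose (pow h j) φ) (mul h′∘φ (deriv φ))
        ≈⟨ mul-cong {compose (pow h j) φ} {pow X j} {mul h′∘φ (deriv φ)} {one}
                    (≗-trans (compose-pow h φ φ0 j) (pow-cong j h∘φ≗X)) (reversion-deriv h φ φ0 h∘φ≗X) ⟩
      mul (pow X j) one                                      ≈⟨ mul-identityʳ (pow X j) ⟩
      pow X j                                                ∎
      where
      open ≗-Reasoning
      h′∘φ = compose (deriv h) φ

    -- Downward induction on j, with r steps left: F − Fⱼ·basis j still vanishes below j + 1.
    lagrange-vanishing-below : ∀ n r j → r ℕ.+ j ≡ suc n → ∀ F → (∀ i → i < j → F i ≡ 0ℤ) →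
                               mul (compose F φ) (deriv φ) n ≡ mul F (pow f (suc n)) n
    lagrange-vanishing-below n zero .(suc n) refl F vanish = trans
      (mul-vanishesˡ (deriv φ) n (compose-vanishes φ n (λ i i≤n → vanish i (s≤s i≤n))))
      (sym (mul-vanishesˡ (pow f (suc n)) n (λ i i≤n → vanish i (s≤s i≤n))))
    lagrange-vanishing-below n (suc r) j r+j≡n F vanish = +-cancelʳ (c * pow X j n) _ _ (begin
      mul (compose F φ) (deriv φ) n + c * pow X j n
        ≡⟨ cong (λ t → mul (compose F φ) (deriv φ) n + c * t) (sym (basis-coeff-compose j n)) ⟩
      mul (compose F φ) (deriv φ) n + c * mul (compose (basis j) φ) (deriv φ) n
        ≡⟨ sym (mul-linearˡ (compose F φ) c (compose (basis j) φ) (deriv φ) n) ⟩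
      mul (compose F φ ⊕ scale c (compose (basis j) φ)) (deriv φ) n
        ≡⟨ sym (mul-congˡ (deriv φ) (compose-linear F c (basis j)) n) ⟩
      mul (compose G φ) (deriv φ) n
        ≡⟨ lagrange-vanishing-below n r (suc j) (trans (ℕₚ.+-suc r j) r+j≡n) G G-vanish ⟩
      mul G (pow f (suc n)) n
        ≡⟨ mul-linearˡ F c (basis j) (pow f (suc n)) n ⟩
      mul F (pow f (suc n)) n + c * mul (basis j) (pow f (suc n)) n
        ≡⟨ cong (λ t → mul F (pow f (suc n)) n + c * t) (basis-coeff-pow j n) ⟩
      mul F (pow f (suc n)) n + c * pow X j n ∎)
      where
      open ≡-Reasoning
      c = - F j
      G = F ⊕ scale c (basis j)
      mul-linearˡ : ∀ a c b e → mul (a ⊕ scale c b) e ≗ mul a e ⊕ scale c (mul b e)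
      mul-linearˡ a c b e = ≗-trans (mul-distribʳ a (scale c b) e) (⊕-cong {mul a e} ≗-refl (mul-scaleˡ c b e))
      compose-linear : ∀ a c b → compose (a ⊕ scale c b) φ ≗ compose a φ ⊕ scale c (compose b φ)
      compose-linear a c b = ≗-trans (compose-⊕ a (scale c b) φ) (⊕-cong {compose a φ} ≗-refl (compose-scale c b φ))
      G-vanish : ∀ i → i < suc j → G i ≡ 0ℤ
      G-vanish i i<1+j with ℕₚ.m≤n⇒m<n∨m≡n (ℕₚ.≤-pred i<1+j)
      ... | inj₁ i<j = trans (cong₂ (λ x y → x + c * y) (vanish i i<j) (basis-below j i<j))
                             (cong (λ t → 0ℤ + t) (*-zeroʳ c))
      ... | inj₂ refl = trans (cong (λ t → F j + c * t) (basis-diagonal j))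
                              (trans (cong (λ t → F j + t) (*-identityʳ c)) (+-inverseʳ (F j)))

    lagrange : ∀ F n → mul (compose F φ) (deriv φ) n ≡ mul F (pow f (suc n)) n
    lagrange F n = lagrange-vanishing-below n (suc n) 0 (ℕₚ.+-identityʳ (suc n)) F (λ _ ())

    deriv-φ-at-0 : deriv φ 0 ≡ 1ℤ
    deriv-φ-at-0 = begin
      deriv φ 0                              ≡⟨ sym (*-identityˡ (deriv φ 0)) ⟩
      deriv h 0 * deriv φ 0                  ≡⟨ cong (_* deriv φ 0) (sym (compose-at-0 (deriv h) φ)) ⟩
      compose (deriv h) φ 0 * deriv φ 0      ≡⟨ sym (mul-at-0 (compose (deriv h) φ) (deriv φ)) ⟩
      mul (compose (deriv h) φ) (deriv φ) 0  ≡⟨ reversion-deriv h φ φ0 h∘φ≗X 0 ⟩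
      1ℤ                                     ∎
      where open ≡-Reasoning

    d∘φ-mul-deriv : mul (compose (d φ) φ) (deriv φ) ≗ compose f φ
    d∘φ-mul-deriv = begin
      mul (compose (d φ) φ) (deriv φ)
        ≈⟨ mul-cong {compose (d φ) φ} {mul (compose f φ) (compose (inv w) φ)} {deriv φ} {compose w φ}
                    (compose-mul φ φ0 f (inv w)) (≗-sym (compose-reversion h φ refl φ0 h∘φ≗X (deriv φ))) ⟩
      mul (mul (compose f φ) (compose (inv w) φ)) (compose w φ)
        ≈⟨ mul-assoc (compose f φ) (compose (inv w) φ) (compose w φ) ⟩
      mul (compose f φ) (mul (compose (inv w) φ) (compose w φ))
        ≈⟨ mul-congʳ (compose f φ) (≗-sym (compose-mul φ φ0 (inv w) w)) ⟩
      mul (compose f φ) (compose (mul (inv w) w) φ)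
        ≈⟨ mul-congʳ (compose f φ) (≗-trans (compose-congˡ φ (mul-invˡ w (trans (compose-at-0 (deriv φ) h) deriv-φ-at-0)))
                                            (compose-one φ)) ⟩
      mul (compose f φ) one
        ≈⟨ mul-identityʳ (compose f φ) ⟩
      compose f φ ∎
      where
      open ≗-Reasoning
      w = compose (deriv φ) h

    inv-d∘φ-mul-compose : ∀ b → mul (inv (compose (d φ) φ)) (compose b φ) ≗ mul (compose (mul b (inv f)) φ) (deriv φ)
    inv-d∘φ-mul-compose b = begin
      mul E (compose b φ)                              ≈⟨ mul-congʳ E (compose-congˡ φ b≗b/f·f) ⟩
      mul E (compose (mul (mul b (inv f)) f) φ)        ≈⟨ mul-congʳ E (compose-mul φ φ0 (mul b (inv f)) f) ⟩
      mul E (mul (compose (mul b (inv f)) φ) (compose f φ))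
                                                       ≈⟨ mul-left-comm E (compose (mul b (inv f)) φ) (compose f φ) ⟩
      mul (compose (mul b (inv f)) φ) (mul E (compose f φ))
                                                       ≈⟨ mul-congʳ (compose (mul b (inv f)) φ) E·f∘φ≗deriv ⟩
      mul (compose (mul b (inv f)) φ) (deriv φ)        ∎
      where
      open ≗-Reasoning
      E = inv (compose (d φ) φ)
      b≗b/f·f : b ≗ mul (mul b (inv f)) f
      b≗b/f·f = ≗-sym (≗-trans (mul-assoc b (inv f) f) (≗-trans (mul-congʳ b (mul-invˡ f f0)) (mul-identityʳ b)))
      d∘φ-at-0 : compose (d φ) φ 0 ≡ 1ℤ
      d∘φ-at-0 = trans (compose-at-0 (d φ) φ) (trans (mul-at-0 f (inv (compose (deriv φ) h))) (trans (*-identityʳ (f 0)) f0))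
      E·f∘φ≗deriv : mul E (compose f φ) ≗ deriv φ
      E·f∘φ≗deriv = ≗-trans (mul-congʳ E (≗-sym d∘φ-mul-deriv)) (inv-mul-cancelˡ (compose (d φ) φ) d∘φ-at-0 (deriv φ))

mainTheorem3 : (g f φ : Series) → g 0 ≡ 1ℤ → f 0 ≡ 1ℤ → IsReversionOf φ (xmul (inv f)) → (n k : ℕ) → Riordan g (xmul f) (2 ℕ.* n) (n ℕ.+ k) ≡ matMul (RiordanInv (mul f (inv (compose (deriv φ) (xmul (inv f))))) φ) (Riordan g (xmul f)) n k
mainTheorem3 g f φ _ f0 (φ0 , h∘φ≗X) n k = begin
  Riordan g (xmul f) (2 ℕ.* n) (n ℕ.+ k)          ≡⟨ cong (λ m → Riordan g (xmul f) (n ℕ.+ m) (n ℕ.+ k)) (ℕₚ.+-identityʳ n) ⟩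
  Riordan g (xmul f) (n ℕ.+ n) (n ℕ.+ k)          ≡⟨ riordan-xmul-shift g f n n k ⟩
  mul (pow f n) column n                          ≡⟨ sym (mul-inv-pow-suc f f0 column n n) ⟩
  mul (mul column (inv f)) (pow f (suc n)) n      ≡⟨ sym (lagrange φ φ0 h∘φ≗X (mul column (inv f)) n) ⟩
  mul (compose (mul column (inv f)) φ) (deriv φ) n ≡⟨ sym (inv-d∘φ-mul-compose φ φ0 h∘φ≗X column n) ⟩
  mul (inv (compose (d φ) φ)) (compose column φ) n
                                                  ≡⟨ sym (riordan-apply (inv (compose (d φ) φ)) φ φ0 column n) ⟩
  matMul (RiordanInv (d φ) φ) (Riordan g (xmul f)) n k ∎
  where
  open ≡-Reasoning
  open Lagrange f f0
  column = mul g (pow (xmul f) k)
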